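{- Let $(S_\bot,M)$ be a $C$-monoid where $M$ is an ada, let $\theta$ be a maximal congruence on $M$, and let $E_\theta=\{(s,t)\in S_\bot\times S_\bot: \beta[s,t]=\beta[t,t] \text{ for some }\beta\in M\text{ with }(\beta,T)\in\theta\}$. Then for all $q,s,t\in S_\bot$: (i) $(q\circ T)[q,\bot]=q$; (ii) $(q\circ T,F)\notin\theta$; (iii) $(q\circ T,U)\in\theta$ if and only if $(q,\bot)\in E_\theta$; (iv) $(q\circ T,T)\in\theta \iff (q\circ F,F)\in\theta \iff (q,\bot)\notin E_\theta$; (v) if $(s,t)\in E_\theta$ then $(s\circ\alpha,t\circ\alpha)\in\theta$ for all $\alpha\in M$; (vi) $(1,\bot)\notin E_\theta$.
   Context: A $C$-algebra is an algebra $(M,\vee,\wedge,\neg)$ of type $(2,2,1)$ satisfying, for all $\alpha,\beta,\gamma$: $\neg\neg\alpha=\alpha$; $\neg(\alpha\wedge\beta)=\neg\alpha\vee\neg\beta$; $(\alpha\wedge\beta)\wedge\gamma=\alpha\wedge(\beta\wedge\gamma)$; $\alpha\wedge(\beta\vee\gamma)=(\alpha\wedge\beta)\vee(\alpha\wedge\gamma)$; $(\alpha\vee\beta)\wedge\gamma=(\alpha\wedge\gamma)\vee(\neg\alpha\wedge\beta\wedge\gamma)$; $\alpha\vee(\alpha\wedge\beta)=\alpha$; $(\alpha\wedge\beta)\vee(\beta\wedge\alpha)=(\beta\wedge\alpha)\vee(\alpha\wedge\beta)$. A $C$-algebra with $T,F,U$ has constants $T$ (two-sided identity for $\wedge$),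 $F$ (two-sided identity for $\vee$), $U$ (fixed point of $\neg$). An ada is a $C$-algebra with $T,F,U$ and a unary operation $(\ )^\downarrow$ with $F^\downarrow=F$, $U^\downarrow=F$, $T^\downarrow=T$, $\alpha\wedge\beta^\downarrow=\alpha\wedge(\alpha\wedge\beta)^\downarrow$, $\alpha^\downarrow\vee\neg(\alpha^\downarrow)=T$, $\alpha=\alpha^\downarrow\vee\alpha$. Write $\alpha\llbracket\beta,\gamma\rrbracket=(\alpha\wedge\beta)\vee(\neg\alpha\wedge\gamma)$. A maximal congruence is a congruence on $M$ maximal among those different from $M\times M$. A $C$-set is a pair $(S_\bot,M)$, $S_\bot$ a pointed set with base point $\bot$, $M$ a $C$-algebra with $T,F,U$, with a map $(\alpha,s,t)\mapsto\alpha[s,t]$, $M\times S_\bot\times S_\bot\to S_\bot$, such that: $U[s,t]=\bot$; $F[s,t]=t$; $(\neg\alpha)[s,t]=\alpha[t,s]$; $\alpha[\alpha[s,t],u]=\alpha[s,u]$; $\alpha[s,\alpha[t,u]]=\alpha[s,u]$; $(\alpha\wedge\beta)[s,t]=\alpha[\beta[s,t],t]$; $\alpha[\beta[s,t],\beta[u,v]]=\beta[\alpha[s,u],\alpha[t,v]]$; and $\alpha[s,t]=\alpha[t,t]\Rightarrow(\alpha\wedge\beta)[s,t]=(\alpha\wedge\beta)[t,t]$. A $C$-monoid is a $C$-set $(S_\bot,M)$ where $(S_\bot,\cdot)$ is a monoid with identity $1$ and zero $\bot$ (the base point), with a map $\circ:S_\bot\times M\to M$ such that for all $s,t,r,u\in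 S_\bot,\alpha,\beta\in M$: $\bot\circ\alpha=U$; $t\circ U=U$; $1\circ\alpha=\alpha$; $s\circ(\neg\alpha)=\neg(s\circ\alpha)$; $s\circ(\alpha\wedge\beta)=(s\circ\alpha)\wedge(s\circ\beta)$; $(s\cdot t)\circ\alpha=s\circ(t\circ\alpha)$; $\alpha[s,t]\cdot u=\alpha[s\cdot u,t\cdot u]$; $r\cdot\alpha[s,t]=(r\circ\alpha)[r\cdot s,r\cdot t]$; $\alpha[s,t]\circ\beta=\alpha\llbracket s\circ\beta,t\circ\beta\rrbracket$. -}

module Defs where

open import Data.Product using (Σ; _×_; _,_)
open import Relation.Binary.PropositionalEquality using (_≡_)
open import Relation.Nullary using (¬_)

record IsCAlgebra {M : Set} (_∨_ _∧_ : M → M → M) (neg : M → M) : Set where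
  field
    negneg   : ∀ a → neg (neg a) ≡ a
    demorgan : ∀ a b → neg (a ∧ b) ≡ neg a ∨ neg b
    ∧-assoc  : ∀ a b c → (a ∧ b) ∧ c ≡ a ∧ (b ∧ c)
    ∧-distʳ  : ∀ a b c → a ∧ (b ∨ c) ≡ (a ∧ b) ∨ (a ∧ c)
    ∨∧-law   : ∀ a b c → (a ∨ b) ∧ c ≡ (a ∧ c) ∨ ((neg a ∧ b) ∧ c)
    absorb   : ∀ a b → a ∨ (a ∧ b) ≡ a
    ∧-comm∨  : ∀ a b → (a ∧ b) ∨ (b ∧ a) ≡ (b ∧ a) ∨ (a ∧ b)

record Ada : Set₁ where
  infixr 6 _∨_
  infixr 7 _∧_
  field
    Carrier : Set
    _∨_ _∧_ : Carrier → Carrier → Carrier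
    neg     : Carrier → Carrier
    T F U   : Carrier
    _↓      : Carrier → Carrier
    isCAlgebra : IsCAlgebra _∨_ _∧_ neg
    T-idˡ : ∀ a → T ∧ a ≡ a
    T-idʳ : ∀ a → a ∧ T ≡ a
    F-idˡ : ∀ a → F ∨ a ≡ a
    F-idʳ : ∀ a → a ∨ F ≡ a
    negU  : neg U ≡ U
    F↓ : F ↓ ≡ F
    U↓ : U ↓ ≡ F
    T↓ : T ↓ ≡ T
    ↓-∧   : ∀ a b → a ∧ (b ↓) ≡ a ∧ ((a ∧ b) ↓)
    ↓-lem : ∀ a → (a ↓) ∨ neg (a ↓) ≡ T
    ↓-abs : ∀ a → a ≡ (a ↓) ∨ a
  open IsCAlgebra isCAlgebra public

  _⟦_,_⟧ : Carrier → Carrier → Carrier → Carrier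
  a ⟦ b , c ⟧ = (a ∧ b) ∨ (neg a ∧ c)

record CMonoid (A : Ada) : Set₁ where
  open Ada A
  infixl 7 _·_
  field
    S    : Set
    bot  : S
    one  : S
    _·_  : S → S → S
    _[_,_] : Carrier → S → S → S
    _∘_  : S → Carrier → Carrier
    U[] : ∀ s t → U [ s , t ] ≡ bot
    F[] : ∀ s t → F [ s , t ] ≡ t
    neg[] : ∀ a s t → (neg a) [ s , t ] ≡ a [ t , s ]
    []-left  : ∀ a s t u → a [ a [ s , t ] , u ] ≡ a [ s , u ]
    []-right : ∀ a s t u → a [ s , a [ t , u ] ] ≡ a [ s , u ]
    ∧[] : ∀ a b s t → (a ∧ b) [ s , t ] ≡ a [ b [ s , t ] , t ]
    []-swap : ∀ a b s t u v →
      a [ b [ s , t ] , b [ u , v ] ] ≡ b [ a [ s , u ] , a [ t , v ] ]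
    []-imp : ∀ a b s t → a [ s , t ] ≡ a [ t , t ] →
      (a ∧ b) [ s , t ] ≡ (a ∧ b) [ t , t ]
    ·-assoc : ∀ s t u → (s · t) · u ≡ s · (t · u)
    ·-idˡ : ∀ s → one · s ≡ s
    ·-idʳ : ∀ s → s · one ≡ s
    ·-zeroˡ : ∀ s → bot · s ≡ bot
    ·-zeroʳ : ∀ s → s · bot ≡ bot
    bot∘ : ∀ a → bot ∘ a ≡ U
    ∘U   : ∀ t → t ∘ U ≡ U
    one∘ : ∀ a → one ∘ a ≡ a
    ∘neg : ∀ s a → s ∘ neg a ≡ neg (s ∘ a)
    ∘∧   : ∀ s a b → s ∘ (a ∧ b) ≡ (s ∘ a) ∧ (s ∘ b)
    ·∘   : ∀ s t a → (s · t) ∘ a ≡ s ∘ (t ∘ a)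
    []·  : ∀ a s t u → (a [ s , t ]) · u ≡ a [ s · u , t · u ]
    ·[]  : ∀ r a s t → r · (a [ s , t ]) ≡ (r ∘ a) [ r · s , r · t ]
    []∘  : ∀ a s t b → (a [ s , t ]) ∘ b ≡ a ⟦ s ∘ b , t ∘ b ⟧

record IsCongruence (A : Ada) (θ : Ada.Carrier A → Ada.Carrier A → Set) : Set where
  open Ada A
  field
    refl  : ∀ a → θ a a
    sym   : ∀ {a b} → θ a b → θ b a
    trans : ∀ {a b c} → θ a b → θ b c → θ a c
    ∨-cong : ∀ {a a' b b'} → θ a a' → θ b b' → θ (a ∨ b) (a' ∨ b')
    ∧-cong : ∀ {a a' b b'} → θ a a' → θ b b' → θ (a ∧ b) (a' ∧ b')
    neg-cong : ∀ {a a'} → θ a a' → θ (neg a) (neg a')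
    ↓-cong : ∀ {a a'} → θ a a' → θ (a ↓) (a' ↓)

IsTotal : (A : Ada) → (Ada.Carrier A → Ada.Carrier A → Set) → Set
IsTotal A θ = ∀ a b → θ a b

record IsMaximalCongruence (A : Ada) (θ : Ada.Carrier A → Ada.Carrier A → Set) : Set₁ where
  field
    isCongruence : IsCongruence A θ
    proper       : ¬ IsTotal A θ
    maximal      : (ψ : Ada.Carrier A → Ada.Carrier A → Set) → IsCongruence A ψ →
                   ¬ IsTotal A ψ → (∀ a b → θ a b → ψ a b) → ∀ a b → ψ a b → θ a b

E : {A : Ada} (C : CMonoid A) → (Ada.Carrier A → Ada.Carrier A → Set) →
    CMonoid.S C → CMonoid.S C → Set
E {A} C θ s t = Σ (Ada.Carrier A) λ β → θ β (Ada.T A) × (β [ s , t ] ≡ β [ t , t ])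
  where open CMonoid C

-- Write γ = q ∘ T. By (i) γ selects q against ⊥, so γ = γ⟦γ,U⟧, which rules
-- out γ θ F; and γ cannot be θ-related to both T and U. If γ θ U then γ↓ θ F,
-- and ¬(γ↓) witnesses E_θ(q,⊥) because (¬(γ↓))[q,⊥] = ⊥. Conversely, if
-- E_θ(q,⊥) fails, relativising θ to γ↓ (a ψ b :⇔ θ(γ↓ ∧ a, γ↓ ∧ b)) gives a
-- proper congruence containing θ, so ψ = θ by maximality; and γ ψ T since
-- γ↓ ∧ γ = γ↓ = γ↓ ∧ T.
module Submission where

open import Defs
open import Data.Product using (_×_; _,_)
open import Function.Bundles using (_⇔_; mk⇔; module Equivalence)
open import Relation.Binary.PropositionalEquality
  using (_≡_; cong; cong₂; subst; module ≡-Reasoning)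
  renaming (sym to ≡-sym; trans to ≡-trans)
open import Relation.Nullary using (¬_)

module AdaProperties (A : Ada) where
  open Ada A
  open ≡-Reasoning

  neg-injective : ∀ {a b} → neg a ≡ neg b → a ≡ b
  neg-injective {a} {b} p = ≡-trans (≡-sym (negneg a)) (≡-trans (cong neg p) (negneg b))

  neg-T : neg T ≡ F
  neg-T = begin
    neg T                ≡⟨ ≡-sym (F-idʳ (neg T)) ⟩
    neg T ∨ F            ≡⟨ cong (neg T ∨_) (≡-sym (negneg F)) ⟩
    neg T ∨ neg (neg F)  ≡⟨ ≡-sym (demorgan T (neg F)) ⟩
    neg (T ∧ neg F)      ≡⟨ cong neg (T-idˡ (neg F)) ⟩
    neg (neg F)          ≡⟨ negneg F ⟩
    F                    ∎

  neg-F : neg F ≡ T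
  neg-F = ≡-trans (cong neg (≡-sym neg-T)) (negneg T)

  ∧-zeroˡ : ∀ a → F ∧ a ≡ F
  ∧-zeroˡ a = ≡-trans (≡-sym (F-idˡ (F ∧ a))) (absorb F a)

  neg-∨ : ∀ a b → neg (a ∨ b) ≡ neg a ∧ neg b
  neg-∨ a b = begin
    neg (a ∨ b)                    ≡⟨ cong neg (cong₂ _∨_ (≡-sym (negneg a)) (≡-sym (negneg b))) ⟩
    neg (neg (neg a) ∨ neg (neg b)) ≡⟨ cong neg (≡-sym (demorgan (neg a) (neg b))) ⟩
    neg (neg (neg a ∧ neg b))      ≡⟨ negneg _ ⟩
    neg a ∧ neg b                  ∎

  ∧-absorbs-∨ : ∀ a b → a ∧ (a ∨ b) ≡ a
  ∧-absorbs-∨ a b = neg-injective (begin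
    neg (a ∧ (a ∨ b))        ≡⟨ demorgan a (a ∨ b) ⟩
    neg a ∨ neg (a ∨ b)      ≡⟨ cong (neg a ∨_) (neg-∨ a b) ⟩
    neg a ∨ (neg a ∧ neg b)  ≡⟨ absorb (neg a) (neg b) ⟩
    neg a                    ∎)

  ∧-idem : ∀ a → a ∧ a ≡ a
  ∧-idem a = ≡-trans (cong (a ∧_) (≡-sym (F-idʳ a))) (∧-absorbs-∨ a F)

  a∨b≡a∨[neg-a∧b] : ∀ a b → a ∨ b ≡ a ∨ (neg a ∧ b)
  a∨b≡a∨[neg-a∧b] a b = begin
    a ∨ b                        ≡⟨ ≡-sym (T-idʳ _) ⟩
    (a ∨ b) ∧ T                  ≡⟨ ∨∧-law a b T ⟩
    (a ∧ T) ∨ ((neg a ∧ b) ∧ T)  ≡⟨ cong₂ _∨_ (T-idʳ a) (T-idʳ _) ⟩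
    a ∨ (neg a ∧ b)              ∎

  a∨T≡a∨neg-a : ∀ a → a ∨ T ≡ a ∨ neg a
  a∨T≡a∨neg-a a = ≡-trans (a∨b≡a∨[neg-a∧b] a T) (cong (a ∨_) (T-idʳ (neg a)))

  a∧neg-a≡a∧F : ∀ a → a ∧ neg a ≡ a ∧ F
  a∧neg-a≡a∧F a = neg-injective (begin
    neg (a ∧ neg a)      ≡⟨ demorgan a (neg a) ⟩
    neg a ∨ neg (neg a)  ≡⟨ ≡-sym (a∨T≡a∨neg-a (neg a)) ⟩
    neg a ∨ T            ≡⟨ cong (neg a ∨_) (≡-sym neg-F) ⟩
    neg a ∨ neg F        ≡⟨ ≡-sym (demorgan a F) ⟩
    neg (a ∧ F)          ∎)

  c∧neg[c∧a]≡c∧neg-a : ∀ c a → c ∧ neg (c ∧ a) ≡ c ∧ neg a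
  c∧neg[c∧a]≡c∧neg-a c a = begin
    c ∧ neg (c ∧ a)            ≡⟨ cong (c ∧_) (demorgan c a) ⟩
    c ∧ (neg c ∨ neg a)        ≡⟨ ∧-distʳ c (neg c) (neg a) ⟩
    (c ∧ neg c) ∨ (c ∧ neg a)  ≡⟨ cong (_∨ (c ∧ neg a)) (a∧neg-a≡a∧F c) ⟩
    (c ∧ F) ∨ (c ∧ neg a)      ≡⟨ ≡-sym (∧-distʳ c F (neg a)) ⟩
    c ∧ (F ∨ neg a)            ≡⟨ cong (c ∧_) (F-idˡ (neg a)) ⟩
    c ∧ neg a                  ∎

  ∨-absorbs-∨ : ∀ a b → a ∨ (b ∨ a) ≡ a ∨ b
  ∨-absorbs-∨ a b = begin
    a ∨ (b ∨ a)                            ≡⟨ a∨b≡a∨[neg-a∧b] a (b ∨ a) ⟩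
    a ∨ (neg a ∧ (b ∨ a))                  ≡⟨ cong (a ∨_) (∧-distʳ (neg a) b a) ⟩
    a ∨ ((neg a ∧ b) ∨ (neg a ∧ a))        ≡⟨ cong (λ z → a ∨ ((neg a ∧ b) ∨ (neg a ∧ z))) (≡-sym (negneg a)) ⟩
    a ∨ ((neg a ∧ b) ∨ (neg a ∧ neg (neg a))) ≡⟨ cong (λ z → a ∨ ((neg a ∧ b) ∨ z)) (a∧neg-a≡a∧F (neg a)) ⟩
    a ∨ ((neg a ∧ b) ∨ (neg a ∧ F))        ≡⟨ cong (a ∨_) (≡-sym (∧-distʳ (neg a) b F)) ⟩
    a ∨ (neg a ∧ (b ∨ F))                  ≡⟨ cong (λ z → a ∨ (neg a ∧ z)) (F-idʳ b) ⟩
    a ∨ (neg a ∧ b)                        ≡⟨ ≡-sym (a∨b≡a∨[neg-a∧b] a b) ⟩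
    a ∨ b                                  ∎

  ∧-absorbs-∧ : ∀ a b → a ∧ (b ∧ a) ≡ a ∧ b
  ∧-absorbs-∧ a b = neg-injective (begin
    neg (a ∧ (b ∧ a))        ≡⟨ demorgan a (b ∧ a) ⟩
    neg a ∨ neg (b ∧ a)      ≡⟨ cong (neg a ∨_) (demorgan b a) ⟩
    neg a ∨ (neg b ∨ neg a)  ≡⟨ ∨-absorbs-∨ (neg a) (neg b) ⟩
    neg a ∨ neg b            ≡⟨ ≡-sym (demorgan a b) ⟩
    neg (a ∧ b)              ∎)

  ∧-distribˡ-∧ : ∀ c a b → c ∧ (a ∧ b) ≡ (c ∧ a) ∧ (c ∧ b)
  ∧-distribˡ-∧ c a b = begin
    c ∧ (a ∧ b)        ≡⟨ ≡-sym (∧-assoc c a b) ⟩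
    (c ∧ a) ∧ b        ≡⟨ cong (_∧ b) (≡-sym (≡-trans (∧-assoc c a c) (∧-absorbs-∧ c a))) ⟩
    ((c ∧ a) ∧ c) ∧ b  ≡⟨ ∧-assoc (c ∧ a) c b ⟩
    (c ∧ a) ∧ (c ∧ b)  ∎

  ∧-zeroʳ-if-classical : ∀ c → c ∨ neg c ≡ T → c ∧ F ≡ F
  ∧-zeroʳ-if-classical c classical = begin
    c ∧ F                            ≡⟨ ≡-sym (F-idʳ _) ⟩
    (c ∧ F) ∨ F                      ≡⟨ cong ((c ∧ F) ∨_) (≡-sym neg-c∧F≡F) ⟩
    (c ∧ F) ∨ (neg c ∧ F)            ≡⟨ cong (λ z → (c ∧ F) ∨ (z ∧ F)) (≡-sym (∧-idem (neg c))) ⟩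
    (c ∧ F) ∨ ((neg c ∧ neg c) ∧ F)  ≡⟨ ≡-sym (∨∧-law c (neg c) F) ⟩
    (c ∨ neg c) ∧ F                  ≡⟨ cong (_∧ F) classical ⟩
    T ∧ F                            ≡⟨ T-idˡ F ⟩
    F                                ∎
    where
    neg-c∧F≡F : neg c ∧ F ≡ F
    neg-c∧F≡F = begin
      neg c ∧ F      ≡⟨ cong (neg c ∧_) (≡-sym neg-T) ⟩
      neg c ∧ neg T  ≡⟨ ≡-sym (neg-∨ c T) ⟩
      neg (c ∨ T)    ≡⟨ cong neg (≡-trans (a∨T≡a∨neg-a c) classical) ⟩
      neg T          ≡⟨ neg-T ⟩
      F              ∎

  T⟦_,_⟧ : ∀ x y → T ⟦ x , y ⟧ ≡ x
  T⟦ x , y ⟧ = begin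
    (T ∧ x) ∨ (neg T ∧ y)  ≡⟨ cong₂ _∨_ (T-idˡ x) (cong (_∧ y) neg-T) ⟩
    x ∨ (F ∧ y)            ≡⟨ cong (x ∨_) (∧-zeroˡ y) ⟩
    x ∨ F                  ≡⟨ F-idʳ x ⟩
    x                      ∎

  F⟦_,_⟧ : ∀ x y → F ⟦ x , y ⟧ ≡ y
  F⟦ x , y ⟧ = begin
    (F ∧ x) ∨ (neg F ∧ y)  ≡⟨ cong₂ _∨_ (∧-zeroˡ x) (cong (_∧ y) neg-F) ⟩
    F ∨ (T ∧ y)            ≡⟨ F-idˡ _ ⟩
    T ∧ y                  ≡⟨ T-idˡ y ⟩
    y                      ∎

  a≡a∧a↓ : ∀ a → a ≡ a ∧ (a ↓)
  a≡a∧a↓ a = begin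
    a                ≡⟨ ≡-sym (T-idʳ a) ⟩
    a ∧ T            ≡⟨ cong (a ∧_) (≡-sym T↓) ⟩
    a ∧ (T ↓)        ≡⟨ ↓-∧ a T ⟩
    a ∧ ((a ∧ T) ↓)  ≡⟨ cong (λ z → a ∧ (z ↓)) (T-idʳ a) ⟩
    a ∧ (a ↓)        ∎

  a↓∧a≡a↓ : ∀ a → (a ↓) ∧ a ≡ a ↓
  a↓∧a≡a↓ a = ≡-trans (cong ((a ↓) ∧_) (↓-abs a)) (∧-absorbs-∨ (a ↓) a)

module CongruenceProperties (A : Ada) {θ : Ada.Carrier A → Ada.Carrier A → Set}
    (isCongruence : IsCongruence A θ) where
  open Ada A
  open AdaProperties A
  open IsCongruence isCongruence public

  ≡⇒θ : ∀ {a b} → a ≡ b → θ a b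
  ≡⇒θ {a} p = subst (θ a) p (refl a)

  ⟦⟧-cong : ∀ {a a' b b' c c'} → θ a a' → θ b b' → θ c c' → θ (a ⟦ b , c ⟧) (a' ⟦ b' , c' ⟧)
  ⟦⟧-cong p q r = ∨-cong (∧-cong p q) (∧-cong (neg-cong p) r)

  ⟦⟧-select : ∀ {β} x y → θ β T → θ (β ⟦ x , y ⟧) x
  ⟦⟧-select x y h = trans (⟦⟧-cong h (refl x) (refl y)) (≡⇒θ T⟦ x , y ⟧)

  θ-T⇔θ-neg-F : ∀ {a} → θ a T ⇔ θ (neg a) F
  θ-T⇔θ-neg-F {a} = mk⇔
    (λ h → trans (neg-cong h) (≡⇒θ neg-T))
    (λ h → trans (≡⇒θ (≡-sym (negneg a))) (trans (neg-cong h) (≡⇒θ neg-F)))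

  T≈F⇒total : θ T F → IsTotal A θ
  T≈F⇒total tf a b = trans (≈F a) (sym (≈F b))
    where
    ≈F : ∀ a → θ a F
    ≈F a = trans (≡⇒θ (≡-sym (T-idˡ a))) (trans (∧-cong tf (refl a)) (≡⇒θ (∧-zeroˡ a)))

  T≈U⇒F≈U : θ T U → θ F U
  T≈U⇒F≈U tu = trans (≡⇒θ (≡-sym neg-T)) (trans (neg-cong tu) (≡⇒θ negU))

  F≈U⇒T≈U : θ F U → θ T U
  F≈U⇒T≈U fu = trans (≡⇒θ (≡-sym neg-F)) (trans (neg-cong fu) (≡⇒θ negU))

  T≈U⇒total : θ T U → IsTotal A θ
  T≈U⇒total tu = T≈F⇒total (trans tu (sym (T≈U⇒F≈U tu)))

  relativise : ∀ c → IsCongruence A (λ a b → θ (c ∧ a) (c ∧ b))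
  relativise c = record
    { refl = λ a → refl (c ∧ a)
    ; sym = sym
    ; trans = trans
    ; ∨-cong = λ {a} {a'} {b} {b'} p q → trans (≡⇒θ (∧-distʳ c a b))
        (trans (∨-cong p q) (≡⇒θ (≡-sym (∧-distʳ c a' b'))))
    ; ∧-cong = λ {a} {a'} {b} {b'} p q → trans (≡⇒θ (∧-distribˡ-∧ c a b))
        (trans (∧-cong p q) (≡⇒θ (≡-sym (∧-distribˡ-∧ c a' b'))))
    ; neg-cong = λ {a} {a'} p → trans (≡⇒θ (≡-sym (c∧neg[c∧a]≡c∧neg-a c a)))
        (trans (∧-cong (refl c) (neg-cong p)) (≡⇒θ (c∧neg[c∧a]≡c∧neg-a c a')))
    ; ↓-cong = λ {a} {a'} p → trans (≡⇒θ (↓-∧ c a))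
        (trans (∧-cong (refl c) (↓-cong p)) (≡⇒θ (≡-sym (↓-∧ c a'))))
    }

module CMonoidProperties {A : Ada} (C : CMonoid A) where
  open Ada A
  open AdaProperties A
  open CMonoid C
  open ≡-Reasoning

  T[_,_] : ∀ s t → T [ s , t ] ≡ s
  T[ s , t ] = begin
    T [ s , t ]      ≡⟨ cong (_[ s , t ]) (≡-sym neg-F) ⟩
    neg F [ s , t ]  ≡⟨ neg[] F s t ⟩
    F [ t , s ]      ≡⟨ F[] t s ⟩
    s                ∎

  [bot,bot] : ∀ β → β [ bot , bot ] ≡ bot
  [bot,bot] β = begin
    β [ bot , bot ]                          ≡⟨ cong₂ (β [_,_]) (≡-sym (U[] bot bot)) (≡-sym (U[] bot bot)) ⟩
    β [ U [ bot , bot ] , U [ bot , bot ] ]  ≡⟨ []-swap β U bot bot bot bot ⟩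
    U [ β [ bot , bot ] , β [ bot , bot ] ]  ≡⟨ U[] _ _ ⟩
    bot                                      ∎

  ∘T-selects : ∀ q → (q ∘ T) [ q , bot ] ≡ q
  ∘T-selects q = begin
    (q ∘ T) [ q , bot ]              ≡⟨ cong₂ ((q ∘ T) [_,_]) (≡-sym (·-idʳ q)) (≡-sym (·-zeroʳ q)) ⟩
    (q ∘ T) [ q · one , q · bot ]    ≡⟨ ≡-sym (·[] q T one bot) ⟩
    q · (T [ one , bot ])            ≡⟨ cong (q ·_) T[ one , bot ] ⟩
    q · one                          ≡⟨ ·-idʳ q ⟩
    q                                ∎

  ∘F≡neg-∘T : ∀ q → q ∘ F ≡ neg (q ∘ T)
  ∘F≡neg-∘T q = ≡-trans (cong (q ∘_) (≡-sym neg-T)) (∘neg q T)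

  ∘T≡∘T⟦∘T,U⟧ : ∀ q → q ∘ T ≡ (q ∘ T) ⟦ q ∘ T , U ⟧
  ∘T≡∘T⟦∘T,U⟧ q = begin
    q ∘ T                      ≡⟨ cong (_∘ T) (≡-sym (∘T-selects q)) ⟩
    ((q ∘ T) [ q , bot ]) ∘ T  ≡⟨ []∘ (q ∘ T) q bot T ⟩
    (q ∘ T) ⟦ q ∘ T , bot ∘ T ⟧ ≡⟨ cong ((q ∘ T) ⟦ q ∘ T ,_⟧) (bot∘ T) ⟩
    (q ∘ T) ⟦ q ∘ T , U ⟧      ∎

  -- x := γ↓[⊥,q] is fixed by γ[_,⊥] (swap γ↓ past γ using (i)), and γ = γ ∧ γ↓ then kills it.
  ∘T↓[bot,_] : ∀ q → ((q ∘ T) ↓) [ bot , q ] ≡ bot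
  ∘T↓[bot, q ] = ≡-trans x≡γ[x,bot] γ[x,bot]≡bot
    where
    γ = q ∘ T
    δ = γ ↓
    x = δ [ bot , q ]
    x≡γ[x,bot] : x ≡ γ [ x , bot ]
    x≡γ[x,bot] = begin
      δ [ bot , q ]                            ≡⟨ cong₂ (δ [_,_]) (≡-sym ([bot,bot] γ)) (≡-sym (∘T-selects q)) ⟩
      δ [ γ [ bot , bot ] , γ [ q , bot ] ]    ≡⟨ []-swap δ γ bot bot q bot ⟩
      γ [ δ [ bot , q ] , δ [ bot , bot ] ]    ≡⟨ cong (γ [ x ,_]) ([bot,bot] δ) ⟩
      γ [ x , bot ]                            ∎
    γ[x,bot]≡bot : γ [ x , bot ] ≡ bot
    γ[x,bot]≡bot = begin
      γ [ x , bot ]                        ≡⟨ cong (_[ x , bot ]) (a≡a∧a↓ γ) ⟩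
      (γ ∧ δ) [ x , bot ]                  ≡⟨ ∧[] γ δ x bot ⟩
      γ [ δ [ δ [ bot , q ] , bot ] , bot ] ≡⟨ cong (γ [_, bot ]) ([]-left δ bot q bot) ⟩
      γ [ δ [ bot , bot ] , bot ]          ≡⟨ cong (γ [_, bot ]) ([bot,bot] δ) ⟩
      γ [ bot , bot ]                      ≡⟨ [bot,bot] γ ⟩
      bot                                  ∎

module EProperties {A : Ada} (C : CMonoid A) {θ : Ada.Carrier A → Ada.Carrier A → Set}
    (isCongruence : IsCongruence A θ) where
  open Ada A
  open AdaProperties A using (neg-F)
  open CMonoid C
  open CMonoidProperties C
  open CongruenceProperties A isCongruence

  E⇒∘-cong : ∀ {s t} → E C θ s t → ∀ α → θ (s ∘ α) (t ∘ α)
  E⇒∘-cong {s} {t} (β , β≈T , β[s,t]≡β[t,t]) α =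
    trans (sym (⟦⟧-select (s ∘ α) (t ∘ α) β≈T))
      (trans (≡⇒θ (≡-trans (≡-sym ([]∘ β s t α)) (≡-trans (cong (_∘ α) β[s,t]≡β[t,t]) ([]∘ β t t α))))
        (⟦⟧-select (t ∘ α) (t ∘ α) β≈T))

  neg-∘T↓≈T⇒E : ∀ q → θ (neg ((q ∘ T) ↓)) T → E C θ q bot
  neg-∘T↓≈T⇒E q h = neg ((q ∘ T) ↓) , h ,
    ≡-trans (neg[] _ q bot) (≡-trans ∘T↓[bot, q ] (≡-sym ([bot,bot] _)))

  E⇒∘T≈U : ∀ {q} → E C θ q bot → θ (q ∘ T) U
  E⇒∘T≈U e = trans (E⇒∘-cong e T) (≡⇒θ (bot∘ T))

  ∘T≈U⇒E : ∀ {q} → θ (q ∘ T) U → E C θ q bot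
  ∘T≈U⇒E {q} h = neg-∘T↓≈T⇒E q (trans (neg-cong (trans (↓-cong h) (≡⇒θ U↓))) (≡⇒θ neg-F))

module MaximalCongruenceProperties {A : Ada} (C : CMonoid A)
    {θ : Ada.Carrier A → Ada.Carrier A → Set} (θ-maximal : IsMaximalCongruence A θ) where
  open Ada A
  open AdaProperties A
  open CMonoid C
  open CMonoidProperties C
  open IsMaximalCongruence θ-maximal
  open CongruenceProperties A isCongruence
  open EProperties C isCongruence

  ∘T≉F : ∀ q → ¬ θ (q ∘ T) F
  ∘T≉F q h = proper (T≈U⇒total (F≈U⇒T≈U F≈U))
    where
    F≈U : θ F U
    F≈U = trans (sym h) (trans (≡⇒θ (∘T≡∘T⟦∘T,U⟧ q))
            (trans (⟦⟧-cong h h (refl U)) (≡⇒θ F⟦ F , U ⟧)))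

  ∘T≈T⇒¬E : ∀ {q} → θ (q ∘ T) T → ¬ E C θ q bot
  ∘T≈T⇒¬E h e = proper (T≈U⇒total (trans (sym h) (E⇒∘T≈U e)))

  ¬E⇒∘T≈T : ∀ {q} → ¬ E C θ q bot → θ (q ∘ T) T
  ¬E⇒∘T≈T {q} ¬e = maximal ψ (relativise c) ψ-proper (λ _ _ → ∧-cong (refl c)) γ T
      (≡⇒θ (≡-trans (a↓∧a≡a↓ γ) (≡-sym (T-idʳ c))))
    where
    γ = q ∘ T
    c = γ ↓
    ψ : Carrier → Carrier → Set
    ψ a b = θ (c ∧ a) (c ∧ b)
    ψ-proper : ¬ IsTotal A ψ
    ψ-proper total = ¬e (neg-∘T↓≈T⇒E q (Equivalence.from θ-T⇔θ-neg-F neg-neg-c≈F))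
      where
      neg-neg-c≈F : θ (neg (neg c)) F
      neg-neg-c≈F = trans (≡⇒θ (≡-trans (negneg c) (≡-sym (T-idʳ c))))
              (trans (total T F) (≡⇒θ (∧-zeroʳ-if-classical c (↓-lem γ))))

  ∘T≈T⇔∘F≈F : ∀ q → θ (q ∘ T) T ⇔ θ (q ∘ F) F
  ∘T≈T⇔∘F≈F q = mk⇔
    (λ h → subst (λ x → θ x F) (≡-sym (∘F≡neg-∘T q)) (Equivalence.to θ-T⇔θ-neg-F h))
    (λ h → Equivalence.from θ-T⇔θ-neg-F (subst (λ x → θ x F) (∘F≡neg-∘T q) h))

  one-¬E-bot : ¬ E C θ one bot
  one-¬E-bot e = proper (T≈U⇒total (subst (λ x → θ x U) (one∘ T) (E⇒∘T≈U e)))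

proposition3p3 : (A : Ada) (C : CMonoid A)
    (θ : Ada.Carrier A → Ada.Carrier A → Set) → IsMaximalCongruence A θ →
    (∀ q → CMonoid._[_,_] C (CMonoid._∘_ C q (Ada.T A)) q (CMonoid.bot C) ≡ q)
    × (∀ q → ¬ θ (CMonoid._∘_ C q (Ada.T A)) (Ada.F A))
    × (∀ q → θ (CMonoid._∘_ C q (Ada.T A)) (Ada.U A) ⇔ E C θ q (CMonoid.bot C))
    × (∀ q → (θ (CMonoid._∘_ C q (Ada.T A)) (Ada.T A) ⇔ θ (CMonoid._∘_ C q (Ada.F A)) (Ada.F A))
             × (θ (CMonoid._∘_ C q (Ada.F A)) (Ada.F A) ⇔ (¬ E C θ q (CMonoid.bot C))))
    × (∀ s t → E C θ s t → ∀ α → θ (CMonoid._∘_ C s α) (CMonoid._∘_ C t α))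
    × (¬ E C θ (CMonoid.one C) (CMonoid.bot C))
proposition3p3 A C θ θ-maximal =
    ∘T-selects
  , ∘T≉F
  , (λ _ → mk⇔ ∘T≈U⇒E E⇒∘T≈U)
  , (λ q → ∘T≈T⇔∘F≈F q
         , mk⇔ (λ h → ∘T≈T⇒¬E (Equivalence.from (∘T≈T⇔∘F≈F q) h))
               (λ ¬e → Equivalence.to (∘T≈T⇔∘F≈F q) (¬E⇒∘T≈T ¬e)))
  , (λ _ _ → E⇒∘-cong)
  , one-¬E-bot
  where
  open CMonoidProperties C
  open IsMaximalCongruence θ-maximal
  open EProperties C isCongruence
  open MaximalCongruenceProperties C θ-maximal
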